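{- Let $n\ge 3$, and let $p,q$ be nonnegative integers with $(p,q)\neq(0,0)$. Let $A$ be an $n\times n$ $0$-$1$ matrix. If $$f(A(i))\le \frac{(n-1)(n-2)}{2}-p\frac{n-1}{2}-q\quad\text{for all } 1\le i\le n,$$ then $$f(A)\le \frac{n(n-1)}{2}-p\frac{n+1}{2}-q-1.$$
   Context: For a $0$-$1$ matrix $A$, $f(A)$ denotes the number of entries equal to $1$ in $A$. For an $n\times n$ matrix $A$ and $1\le i\le n$, $A(i)$ denotes the $(n-1)\times(n-1)$ principal submatrix obtained by deleting the $i$-th row and $i$-th column of $A$. -}

module Defs where

open import Data.Nat using (ℕ; zero; suc; _+_)
open import Data.Bool using (Bool; true; false)
open import Data.Fin using (Fin; zero; suc; punchIn)

Matrix01 : ℕ → Set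
Matrix01 n = Fin n → Fin n → Bool

sumFin : ∀ {n} → (Fin n → ℕ) → ℕ
sumFin {zero}  g = 0
sumFin {suc n} g = g zero + sumFin (λ i → g (suc i))

bit : Bool → ℕ
bit true  = 1
bit false = 0

f : ∀ {n} → Matrix01 n → ℕ
f A = sumFin (λ i → sumFin (λ j → bit (A i j)))

-- A(i): principal submatrix deleting row i and column i.
-- punchIn i enumerates, in increasing order, the indices of Fin (suc m) other than i.
principal : ∀ {m} → Matrix01 (suc m) → Fin (suc m) → Matrix01 m
principal A i j k = A (punchIn i j) (punchIn i k)

-- Summing f(A(i)) = f(A) − rᵢ − cᵢ + aᵢᵢ over i gives Σᵢ f(A(i)) = (n − 2) f(A) + tr A,
-- so (n − 2) f(A) ≤ n h for the largest h = f(A(i)).  The hypothesis at that i reads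
-- 2h ≤ (n − 1)(n − 2) − p(n − 1) − 2q, and p + 2q ≥ 1 makes it strict enough to give
-- (n − 2)(f(A) + p) < (n − 2)(h + n − 1).  Integrality upgrades this to
-- f(A) + p + 1 ≤ h + n − 1, and doubling and substituting the bound on h gives the claim.

module Submission where

module PrincipalMinors where
  open import Defs
  open import Data.Fin using (Fin; zero; suc; punchIn)
  open import Data.Nat
  open import Data.Nat.Properties
  open import Data.Product using (∃-syntax; _,_)
  open import Relation.Binary.PropositionalEquality
  open import Relation.Nullary using (yes; no)
  open import Algebra.Properties.CommutativeMonoid.Sum +-0-commutativeMonoid
    using (sum; sum-remove; ∑-distrib-+; ∑-comm; sum-cong-≗)
  open import Data.Nat.Tactic.RingSolver using (solve-∀)

  sumFin≡sum : ∀ {n} (g : Fin n → ℕ) → sumFin g ≡ sum g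
  sumFin≡sum {zero}  g = refl
  sumFin≡sum {suc n} g = cong (g zero +_) (sumFin≡sum (λ i → g (suc i)))

  sum-const : ∀ n x → sum {n} (λ _ → x) ≡ n * x
  sum-const zero    x = refl
  sum-const (suc n) x = cong (x +_) (sum-const n x)

  sum-mono-≤ : ∀ {n} {g h : Fin n → ℕ} → (∀ i → g i ≤ h i) → sum g ≤ sum h
  sum-mono-≤ {zero}  g≤h = z≤n
  sum-mono-≤ {suc n} g≤h = +-mono-≤ (g≤h zero) (sum-mono-≤ (λ i → g≤h (suc i)))

  maximum-attained : ∀ {n} (g : Fin (suc n) → ℕ) → ∃[ i ] (∀ j → g j ≤ g i)
  maximum-attained {zero}  g = zero , λ { zero → ≤-refl }
  maximum-attained {suc n} g with maximum-attained (λ j → g (suc j))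
  ... | i , gᵢ-max with g zero ≤? g (suc i)
  ...   | yes g₀≤gᵢ = suc i , λ { zero → g₀≤gᵢ ; (suc j) → gᵢ-max j }
  ...   | no  g₀≰gᵢ = zero  , λ { zero → ≤-refl ; (suc j) → ≤-trans (gᵢ-max j) (<⇒≤ (≰⇒> g₀≰gᵢ)) }

  Square : ℕ → Set
  Square n = Fin n → Fin n → ℕ

  total : ∀ {n} → Square n → ℕ
  total M = sum (λ i → sum (M i))

  trace : ∀ {n} → Square n → ℕ
  trace M = sum (λ i → M i i)

  minor : ∀ {n} → Square (suc n) → Fin (suc n) → Square n
  minor M i j k = M (punchIn i j) (punchIn i k)

  minor+row+col≡total+diag : ∀ {n} (M : Square (suc n)) i →
    total (minor M i) + sum (M i) + sum (λ j → M j i) ≡ total M + M i i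
  minor+row+col≡total+diag M i = begin
      T + R + sum (λ j → M j i)   ≡⟨ cong (T + R +_) (sum-remove {i = i} (λ j → M j i)) ⟩
      T + R + (M i i + C′)        ≡⟨ shuffle T R (M i i) C′ ⟩
      R + (C′ + T) + M i i        ≡⟨ cong (_+ M i i) total-by-row-i ⟨
      total M + M i i             ∎
    where
    open ≡-Reasoning
    T R C′ : ℕ
    T = total (minor M i)
    R = sum (M i)
    C′ = sum (λ j → M (punchIn i j) i)
    shuffle : ∀ t r d c → t + r + (d + c) ≡ r + (c + t) + d
    shuffle = solve-∀
    total-by-row-i : total M ≡ R + (C′ + T)
    total-by-row-i = begin
      total M                                                         ≡⟨ sum-remove {i = i} (λ j → sum (M j)) ⟩
      R + sum (λ j → sum (M (punchIn i j)))                           ≡⟨ cong (R +_) (sum-cong-≗ (λ j → sum-remove {i = i} (M (punchIn i j)))) ⟩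
      R + sum (λ j → M (punchIn i j) i + sum (minor M i j))           ≡⟨ cong (R +_) (∑-distrib-+ (λ j → M (punchIn i j) i) (λ j → sum (minor M i j))) ⟩
      R + (C′ + T)                                                    ∎

  ∑-total-minor : ∀ {n} (M : Square (suc n)) →
    sum (λ i → total (minor M i)) + total M + total M ≡ suc n * total M + trace M
  ∑-total-minor {n} M = begin
      sum T + total M + total M                       ≡⟨ cong (sum T + total M +_) (∑-comm M) ⟩
      sum T + sum R + sum C                           ≡⟨ cong (_+ sum C) (∑-distrib-+ T R) ⟨
      sum (λ i → T i + R i) + sum C                   ≡⟨ ∑-distrib-+ (λ i → T i + R i) C ⟨
      sum (λ i → T i + R i + C i)                     ≡⟨ sum-cong-≗ (minor+row+col≡total+diag M) ⟩
      sum (λ i → total M + M i i)                     ≡⟨ ∑-distrib-+ {suc n} (λ _ → total M) (λ i → M i i) ⟩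
      sum {suc n} (λ _ → total M) + trace M           ≡⟨ cong (_+ trace M) (sum-const (suc n) (total M)) ⟩
      suc n * total M + trace M                       ∎
    where
    open ≡-Reasoning
    T R C : Fin (suc n) → ℕ
    T i = total (minor M i)
    R i = sum (M i)
    C i = sum (λ j → M j i)

  total-bound-by-minors : ∀ {c} h (M : Square (2 + c)) →
    (∀ i → total (minor M i) ≤ h) → c * total M ≤ (2 + c) * h
  total-bound-by-minors {c} h M minors≤h = +-cancelʳ-≤ (F + F) (c * F) ((2 + c) * h) (begin
      c * F + (F + F)                          ≡⟨ +-comm (c * F) (F + F) ⟩
      F + F + c * F                            ≡⟨ +-assoc F F (c * F) ⟩
      (2 + c) * F                              ≤⟨ m≤m+n _ (trace M) ⟩
      (2 + c) * F + trace M                    ≡⟨ ∑-total-minor M ⟨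
      sum T + F + F                            ≡⟨ +-assoc (sum T) F F ⟩
      sum T + (F + F)                          ≤⟨ +-monoˡ-≤ (F + F) ∑-minors-bound ⟩
      (2 + c) * h + (F + F)                    ∎)
    where
    open ≤-Reasoning
    F : ℕ
    F = total M
    T : Fin (2 + c) → ℕ
    T i = total (minor M i)
    ∑-minors-bound : sum T ≤ (2 + c) * h
    ∑-minors-bound = ≤-trans (sum-mono-≤ minors≤h) (≤-reflexive (sum-const (2 + c) h))

  ones : ∀ {n} → Matrix01 n → Square n
  ones A i j = bit (A i j)

  f≡total-ones : ∀ {n} (A : Matrix01 n) → f A ≡ total (ones A)
  f≡total-ones A = trans (sumFin≡sum (λ i → sumFin (ones A i))) (sum-cong-≗ (λ i → sumFin≡sum (ones A i)))

  f-bound-by-principal : ∀ {c} h (A : Matrix01 (2 + c)) →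
    (∀ i → f (principal A i) ≤ h) → c * f A ≤ (2 + c) * h
  f-bound-by-principal {c} h A principal≤h =
    subst (λ F → c * F ≤ (2 + c) * h) (sym (f≡total-ones A))
      (total-bound-by-minors h (ones A) (λ i → subst (_≤ h) (f≡total-ones (principal A i)) (principal≤h i)))

module Arithmetic where
  open import Data.Nat
  open import Data.Nat.Properties
  open import Data.Nat.Tactic.RingSolver using (solve)
  open import Data.List using (_∷_; [])
  open ≤-Reasoning

  F+p<h+suc-c : ∀ c p q F h → c * F ≤ (2 + c) * h → 2 * h + (p * suc c + 2 * q) ≤ suc c * c →
    1 ≤ p + 2 * q → F + p < h + suc c
  F+p<h+suc-c c p q F h cF≤ h-bound 1≤p+2q = *-cancelˡ-< c (F + p) (h + suc c) (begin-strict
      c * (F + p)                ≡⟨ *-distribˡ-+ c F p ⟩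
      c * F + c * p              ≤⟨ +-monoˡ-≤ (c * p) cF≤ ⟩
      (2 + c) * h + c * p        ≡⟨ solve (c ∷ p ∷ h ∷ []) ⟩
      c * h + (2 * h + c * p)    <⟨ +-monoʳ-< (c * h) slack ⟩
      c * h + suc c * c          ≡⟨ solve (c ∷ h ∷ []) ⟩
      c * (h + suc c)            ∎)
    where
    slack : 2 * h + c * p < suc c * c
    slack = begin
      suc (2 * h + c * p)             ≡⟨ solve (c ∷ p ∷ h ∷ []) ⟩
      2 * h + c * p + 1               ≤⟨ +-monoʳ-≤ (2 * h + c * p) 1≤p+2q ⟩
      2 * h + c * p + (p + 2 * q)     ≡⟨ solve (c ∷ p ∷ q ∷ h ∷ []) ⟩
      2 * h + (p * suc c + 2 * q)     ≤⟨ h-bound ⟩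
      suc c * c                       ∎

  doubled-count-bound : ∀ c p q F h → c * F ≤ (2 + c) * h → 2 * h + (p * suc c + 2 * q) ≤ suc c * c →
    1 ≤ p + 2 * q → 2 * F + (p * (3 + c) + 2 * q + 2) ≤ (2 + c) * suc c
  doubled-count-bound c p q F h cF≤ h-bound 1≤p+2q = begin
      2 * F + (p * (3 + c) + 2 * q + 2)         ≡⟨ solve (c ∷ p ∷ q ∷ F ∷ []) ⟩
      2 * suc (F + p) + (p * suc c + 2 * q)     ≤⟨ +-monoˡ-≤ _ (*-monoʳ-≤ 2 (F+p<h+suc-c c p q F h cF≤ h-bound 1≤p+2q)) ⟩
      2 * (h + suc c) + (p * suc c + 2 * q)     ≡⟨ solve (c ∷ p ∷ q ∷ h ∷ []) ⟩
      2 * h + (p * suc c + 2 * q) + 2 * suc c   ≤⟨ +-monoˡ-≤ (2 * suc c) h-bound ⟩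
      suc c * c + 2 * suc c                     ≡⟨ solve (c ∷ []) ⟩
      (2 + c) * suc c                           ∎

open import Defs
open import Data.Nat using (ℕ; suc; _≤_)
open import Data.Fin using (Fin)
open import Data.Integer using (ℤ; +_; _-_; _*_)
import Data.Integer as ℤ
open import Data.Product using (_×_; _,_; proj₁; proj₂)
open import Relation.Nullary using (¬_)
open import Relation.Binary.PropositionalEquality using (_≡_)
open import Function using (_⇔_; mk⇔; Equivalence)
open import Relation.Binary.PropositionalEquality using (refl; sym; cong; cong₂; subst; subst₂; module ≡-Reasoning)
open import Data.Empty using (⊥-elim)
import Data.Nat as ℕ
open import Data.Integer.Properties using (+-monoˡ-≤; drop‿+≤+; pos-*)
open import Data.Integer.Tactic.RingSolver using (solve-∀)
open PrincipalMinors using (maximum-attained; f-bound-by-principal)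
open Arithmetic using (doubled-count-bound)

≤-‿⇔+≤ : ∀ {i j k : ℤ} → i ℤ.≤ j - k ⇔ i ℤ.+ k ℤ.≤ j
≤-‿⇔+≤ {i} {j} {k} = mk⇔
    (λ i≤j-k → subst (i ℤ.+ k ℤ.≤_) (cancel-‿+ j k) (+-monoˡ-≤ k i≤j-k))
    (λ i+k≤j → subst (ℤ._≤ j - k) (cancel-+‿ i k) (+-monoˡ-≤ (ℤ.- k) i+k≤j))
  where
  cancel-‿+ : ∀ j k → j - k ℤ.+ k ≡ j
  cancel-‿+ = solve-∀
  cancel-+‿ : ∀ i k → i ℤ.+ k - k ≡ i
  cancel-+‿ = solve-∀

pos-≤-‿⇔+≤ : ∀ {a b c} → + a ℤ.≤ + c - + b ⇔ a ℕ.+ b ≤ c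
pos-≤-‿⇔+≤ {a} {b} {c} = mk⇔
  (λ le → drop‿+≤+ (Equivalence.to (≤-‿⇔+≤ {k = + b}) le))
  (λ le → Equivalence.from (≤-‿⇔+≤ {k = + b}) (ℤ.+≤+ le))

hypothesis-in-ℕ : ∀ c p q h →
  + 2 * + h ℤ.≤ + suc c * (+ suc c - + 1) - + p * + suc c - + 2 * + q →
  2 ℕ.* h ℕ.+ (p ℕ.* suc c ℕ.+ 2 ℕ.* q) ≤ suc c ℕ.* c
hypothesis-in-ℕ c p q h le = Equivalence.to pos-≤-‿⇔+≤ (subst₂ ℤ._≤_ (sym (pos-* 2 h)) bound≡ le)
  where
  open ≡-Reasoning
  regroup : ∀ C P Q → (+ 1 ℤ.+ C) * ((+ 1 ℤ.+ C) - + 1) - P * (+ 1 ℤ.+ C) - + 2 * Q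
                    ≡ (+ 1 ℤ.+ C) * C - (P * (+ 1 ℤ.+ C) ℤ.+ + 2 * Q)
  regroup = solve-∀
  bound≡ : + suc c * (+ suc c - + 1) - + p * + suc c - + 2 * + q ≡ + (suc c ℕ.* c) - + (p ℕ.* suc c ℕ.+ 2 ℕ.* q)
  bound≡ = begin
    + suc c * (+ suc c - + 1) - + p * + suc c - + 2 * + q   ≡⟨ regroup (+ c) (+ p) (+ q) ⟩
    + suc c * + c - (+ p * + suc c ℤ.+ + 2 * + q)           ≡⟨ cong₂ _-_ (pos-* (suc c) c) (cong₂ ℤ._+_ (pos-* p (suc c)) (pos-* 2 q)) ⟨
    + (suc c ℕ.* c) - + (p ℕ.* suc c ℕ.+ 2 ℕ.* q)           ∎

conclusion-from-ℕ : ∀ c p q F →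
  2 ℕ.* F ℕ.+ (p ℕ.* (3 ℕ.+ c) ℕ.+ 2 ℕ.* q ℕ.+ 2) ≤ (2 ℕ.+ c) ℕ.* suc c →
  + 2 * + F ℤ.≤ + suc (suc c) * + suc c - + p * (+ suc (suc c) ℤ.+ + 1) - + 2 * + q - + 2
conclusion-from-ℕ c p q F le = subst₂ ℤ._≤_ (pos-* 2 F) (sym bound≡) (Equivalence.from pos-≤-‿⇔+≤ le)
  where
  open ≡-Reasoning
  regroup : ∀ C P Q → (+ 2 ℤ.+ C) * (+ 1 ℤ.+ C) - P * ((+ 2 ℤ.+ C) ℤ.+ + 1) - + 2 * Q - + 2
                    ≡ (+ 2 ℤ.+ C) * (+ 1 ℤ.+ C) - (P * (+ 3 ℤ.+ C) ℤ.+ + 2 * Q ℤ.+ + 2)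
  regroup = solve-∀
  bound≡ : + suc (suc c) * + suc c - + p * (+ suc (suc c) ℤ.+ + 1) - + 2 * + q - + 2
         ≡ + ((2 ℕ.+ c) ℕ.* suc c) - + (p ℕ.* (3 ℕ.+ c) ℕ.+ 2 ℕ.* q ℕ.+ 2)
  bound≡ = begin
    + suc (suc c) * + suc c - + p * (+ suc (suc c) ℤ.+ + 1) - + 2 * + q - + 2   ≡⟨ regroup (+ c) (+ p) (+ q) ⟩
    + suc (suc c) * + suc c - (+ p * + (3 ℕ.+ c) ℤ.+ + 2 * + q ℤ.+ + 2)        ≡⟨ cong₂ _-_ (pos-* (2 ℕ.+ c) (suc c)) (cong (ℤ._+ + 2) (cong₂ ℤ._+_ (pos-* p (3 ℕ.+ c)) (pos-* 2 q))) ⟨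
    + ((2 ℕ.+ c) ℕ.* suc c) - + (p ℕ.* (3 ℕ.+ c) ℕ.+ 2 ℕ.* q ℕ.+ 2)             ∎

p+2q-positive : ∀ p q → ¬ (p ≡ 0 × q ≡ 0) → 1 ≤ p ℕ.+ 2 ℕ.* q
p+2q-positive (suc p) q       _      = ℕ.s≤s ℕ.z≤n
p+2q-positive 0       (suc q) _      = ℕ.s≤s ℕ.z≤n
p+2q-positive 0       0       p,q≢0 = ⊥-elim (p,q≢0 (refl , refl))

lemma4 : (m p q : ℕ) → 3 ≤ suc m → ¬ (p ≡ 0 × q ≡ 0) → (A : Matrix01 (suc m)) →
    (∀ (i : Fin (suc m)) →
      + 2 * + f (principal A i) ℤ.≤ + m * (+ m - + 1) - + p * + m - + 2 * + q) →
    + 2 * + f A ℤ.≤ + suc m * + m - + p * (+ suc m ℤ.+ + 1) - + 2 * + q - + 2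
lemma4 0       p q (ℕ.s≤s ()) _ _ _
lemma4 (suc c) p q _ p,q≢0 A principal-bound =
  conclusion-from-ℕ c p q (f A)
    (doubled-count-bound c p q (f A) h
      (f-bound-by-principal h A i₀-max)
      (hypothesis-in-ℕ c p q h (principal-bound i₀))
      (p+2q-positive p q p,q≢0))
  where
  i₀ : Fin (suc (suc c))
  i₀ = proj₁ (maximum-attained (λ i → f (principal A i)))
  h : ℕ
  h = f (principal A i₀)
  i₀-max : ∀ i → f (principal A i) ≤ h
  i₀-max = proj₂ (maximum-attained (λ i → f (principal A i)))
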